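{- Define, for positive integers $x,y,z\ge 1$, the polynomials \[ p_1(x,y,z)=x(4yz-1)-yz,\quad p_2(x,y,z)=x(4yz-z-1)-yz,\quad p_3(x,y,z)=x(8y-3)-6y+2,\quad p_4(x,y,z)=x^2-x. \] Assume that every positive integer $q\ge 1$ equals $p_i(x,y,z)$ for some $i\in\{1,2,3,4\}$ and some positive integers $x,y,z$. Then every prime number of the form $4q+1$ with $q\ge 1$ can be written as $4p_2(x,y,z)+1$ for some positive integers $x,y,z$.
   Context: The variables $x,y,z$ range over the positive integers. -}

module Defs where

open import Data.Nat using (ℕ)
open import Data.Integer using (ℤ; +_; _+_; _-_; _*_)

-- The four polynomials, evaluated in ℤ at natural-number arguments
-- (no truncated subtraction).
p₁ : ℕ → ℕ → ℕ → ℤ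
p₁ x y z = (+ x) * ((+ 4) * (+ y) * (+ z) - + 1) - (+ y) * (+ z)

p₂ : ℕ → ℕ → ℕ → ℤ
p₂ x y z = (+ x) * ((+ 4) * (+ y) * (+ z) - + z - + 1) - (+ y) * (+ z)

p₃ : ℕ → ℕ → ℕ → ℤ
p₃ x y z = (+ x) * ((+ 8) * (+ y) - + 3) - (+ 6) * (+ y) + + 2

p₄ : ℕ → ℕ → ℕ → ℤ
p₄ x y z = (+ x) * (+ x) - + x

-- For q = pᵢ(x, y, z) with i ≠ 2, the number 4q + 1 factors:
--   4 p₁ + 1 = (4x − 1)(4yz − 1),  4 p₃ + 1 = (4x − 3)(8y − 3),  4 p₄ + 1 = (2x − 1)²,
-- with both factors at least 2 unless x = 1, where
-- p₃(1, y, z) = 2y − 1 = p₂(1, 1, y), and p₄(1, y, z) = 0 is excluded by q ≥ 1.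
module Submission where

open import Defs
open import Data.Nat using (ℕ; _≤_; suc; zero; s≤s; z≤n; 2+) renaming (_*_ to _*ℕ_; _+_ to _+ℕ_)
open import Data.Nat.Properties using (≤-refl; m<m*n; <⇒≢)
open import Data.Nat.Divisibility using (m∣m*n)
open import Data.Nat.Primality using (Prime; composite; composite⇒¬prime)
open import Data.Integer using (+_; _+_; _*_; _-_)
open import Data.Integer.Properties using (pos-+; pos-*; +-injective; +-comm)
open import Data.Integer.Tactic.RingSolver using (solve-∀)
open import Data.Product using (_×_; ∃-syntax; _,_)
open import Data.Sum using (_⊎_; inj₁; inj₂)
open import Function using (_∘_)
open import Relation.Nullary using (¬_; contradiction)
open import Relation.Binary.PropositionalEquality using (_≡_; refl; sym; trans; cong; cong₂; subst; module ≡-Reasoning)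

open ≡-Reasoning

¬prime-product : ∀ {a b} → 2 ≤ a → 2 ≤ b → ¬ Prime (a *ℕ b)
¬prime-product {a} {b} (s≤s (s≤s _)) 1<b = composite⇒¬prime (composite (m<m*n a b 1<b) (m∣m*n b))

¬prime-pos-product : ∀ {n} a b → + n ≡ + a * + b → 2 ≤ a → 2 ≤ b → ¬ Prime n
¬prime-pos-product a b n≡ab 2≤a 2≤b =
  ¬prime-product 2≤a 2≤b ∘ subst Prime (+-injective (trans n≡ab (sym (pos-* a b))))

pos-+-* : ∀ r k m → + (r +ℕ k *ℕ m) ≡ + r + + k * + m
pos-+-* r k m = trans (pos-+ r (k *ℕ m)) (cong (_+_ (+ r)) (pos-* k m))

pos-4q+1 : ∀ {q v} → + q ≡ v → + suc (4 *ℕ q) ≡ + 4 * v + + 1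
pos-4q+1 {q} refl = trans (pos-+-* 1 4 q) (+-comm (+ 1) (+ 4 * + q))

-- c + b (1 + c) = (1 + b)(1 + c) − 1, i.e. yz − 1.
4p₁+1-factorisation : ∀ a b c →
  + 4 * p₁ (suc a) (suc b) (suc c) + + 1 ≡ + (3 +ℕ 4 *ℕ a) * + (3 +ℕ 4 *ℕ (c +ℕ b *ℕ suc c))
4p₁+1-factorisation a b c = begin
    + 4 * p₁ (suc a) (suc b) (suc c) + + 1
  ≡⟨ identity (+ a) (+ b) (+ c) ⟩
    (+ 3 + + 4 * + a) * (+ 3 + + 4 * (+ c + + b * + suc c))
  ≡⟨ cong (λ w → (+ 3 + + 4 * + a) * (+ 3 + + 4 * w)) (pos-+-* c b (suc c)) ⟨
    (+ 3 + + 4 * + a) * (+ 3 + + 4 * + (c +ℕ b *ℕ suc c))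
  ≡⟨ cong₂ _*_ (pos-+-* 3 4 a) (pos-+-* 3 4 (c +ℕ b *ℕ suc c)) ⟨
    + (3 +ℕ 4 *ℕ a) * + (3 +ℕ 4 *ℕ (c +ℕ b *ℕ suc c))
  ∎
  where
  identity : ∀ A B C →
    + 4 * ((+ 1 + A) * (+ 4 * (+ 1 + B) * (+ 1 + C) - + 1) - (+ 1 + B) * (+ 1 + C)) + + 1
      ≡ (+ 3 + + 4 * A) * (+ 3 + + 4 * (C + B * (+ 1 + C)))
  identity = solve-∀

4p₃+1-factorisation : ∀ a b z →
  + 4 * p₃ (2+ a) (suc b) z + + 1 ≡ + (5 +ℕ 4 *ℕ a) * + (5 +ℕ 8 *ℕ b)
4p₃+1-factorisation a b z = begin
    + 4 * p₃ (2+ a) (suc b) z + + 1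
  ≡⟨ identity (+ a) (+ b) ⟩
    (+ 5 + + 4 * + a) * (+ 5 + + 8 * + b)
  ≡⟨ cong₂ _*_ (pos-+-* 5 4 a) (pos-+-* 5 8 b) ⟨
    + (5 +ℕ 4 *ℕ a) * + (5 +ℕ 8 *ℕ b)
  ∎
  where
  identity : ∀ A B →
    + 4 * ((+ 2 + A) * (+ 8 * (+ 1 + B) - + 3) - + 6 * (+ 1 + B) + + 2) + + 1
      ≡ (+ 5 + + 4 * A) * (+ 5 + + 8 * B)
  identity = solve-∀

4p₄+1-factorisation : ∀ a y z →
  + 4 * p₄ (2+ a) y z + + 1 ≡ + (3 +ℕ 2 *ℕ a) * + (3 +ℕ 2 *ℕ a)
4p₄+1-factorisation a y z = begin
    + 4 * p₄ (2+ a) y z + + 1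
  ≡⟨ identity (+ a) ⟩
    (+ 3 + + 2 * + a) * (+ 3 + + 2 * + a)
  ≡⟨ cong₂ _*_ (pos-+-* 3 2 a) (pos-+-* 3 2 a) ⟨
    + (3 +ℕ 2 *ℕ a) * + (3 +ℕ 2 *ℕ a)
  ∎
  where
  identity : ∀ A →
    + 4 * ((+ 2 + A) * (+ 2 + A) - (+ 2 + A)) + + 1 ≡ (+ 3 + + 2 * A) * (+ 3 + + 2 * A)
  identity = solve-∀

p₃[1,y,z]≡p₂[1,1,y] : ∀ y z → p₃ 1 y z ≡ p₂ 1 1 y
p₃[1,y,z]≡p₂[1,1,y] y z = identity (+ y)
  where
  identity : ∀ Y → + 1 * (+ 8 * Y - + 3) - + 6 * Y + + 2 ≡ + 1 * (+ 4 * + 1 * Y - Y - + 1) - + 1 * Y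
  identity = solve-∀

¬prime-4p₁+1 : ∀ {n x y z} → 1 ≤ x → 1 ≤ y → 1 ≤ z → + n ≡ + 4 * p₁ x y z + + 1 → ¬ Prime n
¬prime-4p₁+1 {x = suc a} {suc b} {suc c} _ _ _ n≡ =
  ¬prime-pos-product (3 +ℕ 4 *ℕ a) (3 +ℕ 4 *ℕ (c +ℕ b *ℕ suc c))
    (trans n≡ (4p₁+1-factorisation a b c)) (s≤s (s≤s z≤n)) (s≤s (s≤s z≤n))

¬prime-4p₃+1 : ∀ {n y} a z → 1 ≤ y → + n ≡ + 4 * p₃ (2+ a) y z + + 1 → ¬ Prime n
¬prime-4p₃+1 {y = suc b} a z _ n≡ =
  ¬prime-pos-product (5 +ℕ 4 *ℕ a) (5 +ℕ 8 *ℕ b)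
    (trans n≡ (4p₃+1-factorisation a b z)) (s≤s (s≤s z≤n)) (s≤s (s≤s z≤n))

¬prime-4p₄+1 : ∀ {n} a y z → + n ≡ + 4 * p₄ (2+ a) y z + + 1 → ¬ Prime n
¬prime-4p₄+1 a y z n≡ =
  ¬prime-pos-product (3 +ℕ 2 *ℕ a) (3 +ℕ 2 *ℕ a)
    (trans n≡ (4p₄+1-factorisation a y z)) (s≤s (s≤s z≤n)) (s≤s (s≤s z≤n))

theorem3 :
    (∀ (q : ℕ) → 1 ≤ q →
      ∃[ x ] ∃[ y ] ∃[ z ] (1 ≤ x × 1 ≤ y × 1 ≤ z ×
        (+ q ≡ p₁ x y z ⊎ + q ≡ p₂ x y z ⊎ + q ≡ p₃ x y z ⊎ + q ≡ p₄ x y z))) →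
    ∀ (q : ℕ) → 1 ≤ q → Prime (suc (4 *ℕ q)) →
      ∃[ x ] ∃[ y ] ∃[ z ] (1 ≤ x × 1 ≤ y × 1 ≤ z ×
        + suc (4 *ℕ q) ≡ (+ 4) * p₂ x y z + + 1)
theorem3 cover q q≥1 4q+1-prime with cover q q≥1
... | zero , _ , _ , () , _
... | x , y , z , x≥1 , y≥1 , z≥1 , inj₁ q≡p₁ =
  contradiction 4q+1-prime (¬prime-4p₁+1 x≥1 y≥1 z≥1 (pos-4q+1 q≡p₁))
... | x , y , z , x≥1 , y≥1 , z≥1 , inj₂ (inj₁ q≡p₂) =
  x , y , z , x≥1 , y≥1 , z≥1 , pos-4q+1 q≡p₂
... | 1 , y , z , _ , y≥1 , _ , inj₂ (inj₂ (inj₁ q≡p₃)) =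
  1 , 1 , y , ≤-refl , ≤-refl , y≥1 , pos-4q+1 (trans q≡p₃ (p₃[1,y,z]≡p₂[1,1,y] y z))
... | 2+ a , _ , z , _ , y≥1 , _ , inj₂ (inj₂ (inj₁ q≡p₃)) =
  contradiction 4q+1-prime (¬prime-4p₃+1 a z y≥1 (pos-4q+1 q≡p₃))
... | 1 , _ , _ , _ , _ , _ , inj₂ (inj₂ (inj₂ q≡0)) =
  contradiction (sym (+-injective q≡0)) (<⇒≢ q≥1)
... | 2+ a , y , z , _ , _ , _ , inj₂ (inj₂ (inj₂ q≡p₄)) =
  contradiction 4q+1-prime (¬prime-4p₄+1 a y z (pos-4q+1 q≡p₄))
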